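{- If $\mathbb{S}=(A,\Diamond,\blacksquare)$ is a tense slanted BAE, then its canonical extension $\mathbb{S}^\delta=(A^\delta,\Diamond^\sigma,\blacksquare^\pi)$ is a perfect tense BAE; in particular $\Diamond^\sigma u\leq v$ iff $u\leq\blacksquare^\pi v$ for all $u,v\in A^\delta$.
   Context: For a Boolean algebra $A$, $A^\delta$ denotes its canonical extension: a complete (and atomic) Boolean algebra containing $A$ as a dense subalgebra (every element is a join of meets and a meet of joins of elements of $A$) that is compact (if $\bigwedge S\leq\bigvee T$ for $S,T\subseteq A$ then the same holds for finite $S'\subseteq S,T'\subseteq T$). $K(A^\delta)$ (closed) are meets, $O(A^\delta)$ (open) joins, of subsets of $A$. A tense slanted BAE is $(A,\Diamond,\blacksquare)$ with $A$ a Boolean algebra, $\Diamond:A\to A^\delta$ preserving finite (incl. empty) joins with range in $K(A^\delta)$, $\blacksquare:A\to A^\delta$ preserving finite (incl. empty) meets with range in $O(A^\delta)$, and $\Diamond a\leq b$ iff $a\leq\blacksquare b$ for all $a,b\in A$. $\Diamond^\sigma(k)=\bigwedge\{\Diamond a\mid a\in A,k\leq a\}$ for $k\in K(A^\delta)$ and $\Diamond^\sigma(u)=\bigvee\{\Diamond^\sigma k\mid k\in K(A^\delta),k\leq u\}$; $\blacksquare^\pi(o)=\bigvee\{\blacksquare a\mid a\in A,a\leq o\}$ for $o\in O(A^\delta)$ and $\blacksquare^\pi(u)=\bigwedge\{\blacksquare^\pi o\mid o\in O(A^\delta),u\leq o\}$. A perfect tense BAE is $(B,\Diamond,\blacksquare)$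 with $B$ a complete atomic Boolean algebra and $\Diamond,\blacksquare:B\to B$ satisfying $\Diamond x\leq y$ iff $x\leq\blacksquare y$. -}

module Defs where

open import Level using (Level; suc; Lift)
open import Algebra.Lattice.Bundles using (BooleanAlgebra)
open import Relation.Unary using (Pred)
open import Relation.Nullary using (¬_)
open import Data.Product using (Σ; ∃; ∃₂; _×_; _,_)
open import Data.Sum using (_⊎_)
open import Data.List using (List; foldr)
open import Data.List.Relation.Unary.All using (All)

module BA {ℓ : Level} (B : BooleanAlgebra ℓ ℓ) where
  open BooleanAlgebra B public renaming (¬_ to compl)

  _≤_ : Carrier → Carrier → Set ℓ
  x ≤ y = (x ∧ y) ≈ x

  IsAtom : Carrier → Set ℓ
  IsAtom a = ¬ (a ≈ ⊥) × (∀ y → y ≤ a → (y ≈ ⊥) ⊎ (y ≈ a))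

  ⋀fin : List Carrier → Carrier
  ⋀fin = foldr _∧_ ⊤

  ⋁fin : List Carrier → Carrier
  ⋁fin = foldr _∨_ ⊥

-- A complete atomic Boolean algebra.  Arbitrary subsets of the carrier
-- (which lives in Set ℓ) are represented by predicates of level suc ℓ.
record CompleteAtomic {ℓ : Level} (C : BooleanAlgebra ℓ ℓ) : Set (suc (suc ℓ)) where
  open BA C
  field
    ⋁ : Pred Carrier (suc ℓ) → Carrier
    ⋁-upper : ∀ (P : Pred Carrier (suc ℓ)) x → P x → x ≤ ⋁ P
    ⋁-least : ∀ (P : Pred Carrier (suc ℓ)) y → (∀ x → P x → x ≤ y) → ⋁ P ≤ y
    ⋀ : Pred Carrier (suc ℓ) → Carrier
    ⋀-lower : ∀ (P : Pred Carrier (suc ℓ)) x → P x → ⋀ P ≤ x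
    ⋀-greatest : ∀ (P : Pred Carrier (suc ℓ)) y → (∀ x → P x → y ≤ x) → y ≤ ⋀ P
    atomic : ∀ x → ¬ (x ≈ ⊥) → ∃ λ at → IsAtom at × at ≤ x

record CanonicalExtension {ℓ : Level} (A : BooleanAlgebra ℓ ℓ)
                          (C : BooleanAlgebra ℓ ℓ) : Set (suc (suc ℓ)) where
  private
    module A = BA A
    module C = BA C
  field
    completeAtomic : CompleteAtomic C
  open CompleteAtomic completeAtomic public
  field
    e : A.Carrier → C.Carrier
    e-cong : ∀ {a b} → a A.≈ b → e a C.≈ e b
    e-∨ : ∀ a b → e (a A.∨ b) C.≈ (e a C.∨ e b)
    e-∧ : ∀ a b → e (a A.∧ b) C.≈ (e a C.∧ e b)
    e-compl : ∀ a → e (A.compl a) C.≈ C.compl (e a)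
    e-⊤ : e A.⊤ C.≈ C.⊤
    e-⊥ : e A.⊥ C.≈ C.⊥
    e-injective : ∀ {a b} → e a C.≈ e b → a A.≈ b

  img : Pred A.Carrier ℓ → Pred C.Carrier (suc ℓ)
  img S x = Lift (suc ℓ) (∃ λ a → S a × (x C.≈ e a))

  Closed : C.Carrier → Set (suc ℓ)
  Closed k = ∃ λ (S : Pred A.Carrier ℓ) → k C.≈ ⋀ (img S)

  Open : C.Carrier → Set (suc ℓ)
  Open o = ∃ λ (S : Pred A.Carrier ℓ) → o C.≈ ⋁ (img S)

  field
    dense-closed : ∀ u → u C.≈ ⋁ (λ k → Closed k × (k C.≤ u))
    dense-open : ∀ u → u C.≈ ⋀ (λ o → Open o × (u C.≤ o))
    compact : ∀ (S T : Pred A.Carrier ℓ) → ⋀ (img S) C.≤ ⋁ (img T) →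
              ∃₂ λ (S′ T′ : List A.Carrier) →
                All S S′ × All T T′ × (A.⋀fin S′ A.≤ A.⋁fin T′)

record IsTenseSlanted {ℓ : Level} {A C : BooleanAlgebra ℓ ℓ}
                      (ext : CanonicalExtension A C)
                      (◇ ■ : BooleanAlgebra.Carrier A → BooleanAlgebra.Carrier C)
                      : Set (suc ℓ) where
  private
    module A = BA A
    module C = BA C
  open CanonicalExtension ext
  field
    ◇-cong : ∀ {a b} → a A.≈ b → ◇ a C.≈ ◇ b
    ◇-∨ : ∀ a b → ◇ (a A.∨ b) C.≈ (◇ a C.∨ ◇ b)
    ◇-⊥ : ◇ A.⊥ C.≈ C.⊥
    ◇-closed : ∀ a → Closed (◇ a)
    ■-cong : ∀ {a b} → a A.≈ b → ■ a C.≈ ■ b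
    ■-∧ : ∀ a b → ■ (a A.∧ b) C.≈ (■ a C.∧ ■ b)
    ■-⊤ : ■ A.⊤ C.≈ C.⊤
    ■-open : ∀ a → Open (■ a)
    adj⇒ : ∀ a b → ◇ a C.≤ e b → e a C.≤ ■ b
    adj⇐ : ∀ a b → e a C.≤ ■ b → ◇ a C.≤ e b

module Extensions {ℓ : Level} {A C : BooleanAlgebra ℓ ℓ}
                  (ext : CanonicalExtension A C)
                  (◇ ■ : BooleanAlgebra.Carrier A → BooleanAlgebra.Carrier C) where
  private
    module A = BA A
    module C = BA C
  open CanonicalExtension ext

  ◇σK : C.Carrier → C.Carrier
  ◇σK k = ⋀ (λ x → Lift (suc ℓ) (∃ λ a → (k C.≤ e a) × (x C.≈ ◇ a)))

  ◇σ : C.Carrier → C.Carrier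
  ◇σ u = ⋁ (λ x → ∃ λ k → Closed k × (k C.≤ u) × (x C.≈ ◇σK k))

  ■πO : C.Carrier → C.Carrier
  ■πO o = ⋁ (λ x → Lift (suc ℓ) (∃ λ a → (e a C.≤ o) × (x C.≈ ■ a)))

  ■π : C.Carrier → C.Carrier
  ■π u = ⋀ (λ x → ∃ λ o → Open o × (u C.≤ o) × (x C.≈ ■πO o))

record IsPerfectTenseBAE {ℓ : Level} (B : BooleanAlgebra ℓ ℓ)
                         (◇ ■ : BooleanAlgebra.Carrier B → BooleanAlgebra.Carrier B)
                         : Set (suc (suc ℓ)) where
  open BA B
  field
    completeAtomic : CompleteAtomic B
    adjunction⇒ : ∀ x y → ◇ x ≤ y → x ≤ ■ y
    adjunction⇐ : ∀ x y → x ≤ ■ y → ◇ x ≤ y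

-- For closed k and open o the adjunction ◇σ k ≤ o ⇔ k ≤ ■π o is an instance of compactness:
-- ◇σ k is the meet of the down-directed family {◇ a ∣ k ≤ a} of closed elements, so if it lies
-- below the open o then already some ◇ a does, and compactness then interpolates an element b of A
-- with ◇ a ≤ b ≤ o; the adjunction ◇ ⊣ ■ on A turns this into k ≤ a ≤ ■ b ≤ ■π o.  The converse is
-- dual.  Density then lifts the adjunction to all of A^δ, since every element is a join of closed
-- and a meet of open elements.
module Submission where

open import Defs
open import Level using (Level; suc; Lift; lift)
open import Algebra.Lattice.Bundles using (BooleanAlgebra)
import Algebra.Lattice.Properties.Lattice as LatticeProperties
import Algebra.Lattice.Properties.BooleanAlgebra as BooleanAlgebraProperties
open import Data.Product using (∃; _×_; _,_; proj₁; proj₂)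
open import Data.List using ([]; _∷_)
open import Data.List.Relation.Unary.All using (All; []; _∷_)
open import Relation.Binary.Bundles using (Poset)
import Relation.Binary.Lattice as OrderLattice
import Relation.Binary.Reasoning.PartialOrder as ≤-Reasoning
open import Relation.Unary using (Pred; _⊆_)
open import Function using (case_of_)

module BooleanOrder {ℓ : Level} (B : BooleanAlgebra ℓ ℓ) where
  open BA B
  open BooleanAlgebraProperties B using (∧-identityʳ; ∧-zeroˡ)

  -- The library orders a lattice by x ≈ x ∧ y, the symmetric form of x ∧ y ≈ x.
  private
    module L = OrderLattice.Lattice (LatticeProperties.∨-∧-orderTheoreticLattice lattice)

  poset : Poset ℓ ℓ ℓ
  poset = record
    { isPartialOrder = record
      { isPreorder = record
        { isEquivalence = isEquivalence
        ; reflexive = λ x≈y → sym (L.reflexive x≈y)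
        ; trans = λ x≤y y≤z → sym (L.trans (sym x≤y) (sym y≤z))
        }
      ; antisym = λ x≤y y≤x → L.antisym (sym x≤y) (sym y≤x)
      }
    }

  open Poset poset public
    using (≤-respˡ-≈; ≤-respʳ-≈) renaming (trans to ≤-trans)

  x∧y≤x : ∀ x y → (x ∧ y) ≤ x
  x∧y≤x x y = sym (L.x∧y≤x x y)

  x∧y≤y : ∀ x y → (x ∧ y) ≤ y
  x∧y≤y x y = sym (L.x∧y≤y x y)

  ∧-greatest : ∀ {x y z} → x ≤ y → x ≤ z → x ≤ (y ∧ z)
  ∧-greatest x≤y x≤z = sym (L.∧-greatest (sym x≤y) (sym x≤z))

  x≤x∨y : ∀ x y → x ≤ (x ∨ y)
  x≤x∨y x y = sym (L.x≤x∨y x y)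

  y≤x∨y : ∀ x y → y ≤ (x ∨ y)
  y≤x∨y x y = sym (L.y≤x∨y x y)

  ∨-least : ∀ {x y z} → x ≤ z → y ≤ z → (x ∨ y) ≤ z
  ∨-least x≤z y≤z = sym (L.∨-least (sym x≤z) (sym y≤z))

  x≤⊤ : ∀ x → x ≤ ⊤
  x≤⊤ = ∧-identityʳ

  ⊥≤x : ∀ x → ⊥ ≤ x
  ⊥≤x = ∧-zeroˡ

  ≤⇒∨≈ : ∀ {x y} → x ≤ y → (x ∨ y) ≈ y
  ≤⇒∨≈ {x} {y} x≤y = trans (∨-congʳ (sym x≤y))
                       (trans (∨-comm (x ∧ y) y)
                         (trans (∨-congˡ (∧-comm x y)) (∨-absorbs-∧ y x)))

module Monotone {ℓ : Level} (A C : BooleanAlgebra ℓ ℓ) (f : BA.Carrier A → BA.Carrier C)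
                (f-cong : ∀ {a b} → BA._≈_ A a b → BA._≈_ C (f a) (f b)) where
  private
    module A = BA A
    module C = BA C
    module AO = BooleanOrder A
    module CO = BooleanOrder C

  ∨-preserving⇒monotone : (∀ a b → f (a A.∨ b) C.≈ (f a C.∨ f b)) →
                          ∀ {a b} → a A.≤ b → f a C.≤ f b
  ∨-preserving⇒monotone f-∨ {a} {b} a≤b =
    CO.≤-respʳ-≈ (C.trans (C.sym (f-∨ a b)) (f-cong (AO.≤⇒∨≈ a≤b))) (CO.x≤x∨y (f a) (f b))

  ∧-preserving⇒monotone : (∀ a b → f (a A.∧ b) C.≈ (f a C.∧ f b)) →
                          ∀ {a b} → a A.≤ b → f a C.≤ f b
  ∧-preserving⇒monotone f-∧ {a} {b} a≤b =
    CO.≤-respˡ-≈ (C.trans (C.sym (f-∧ a b)) (f-cong a≤b)) (CO.x∧y≤y (f a) (f b))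

module CanonicalExtensionProperties {ℓ : Level} {A C : BooleanAlgebra ℓ ℓ}
                                    (ext : CanonicalExtension A C) where
  private
    module A = BA A
    module C = BA C
    module AO = BooleanOrder A
  open BooleanOrder C
  open CanonicalExtension ext
  open ≤-Reasoning poset

  -- The family {f a ∣ D a}.  Definitionally img S = family S e, ◇σK k = ⋀ (family (λ a → k ≤ e a) ◇)
  -- and ■πO o = ⋁ (family (λ a → e a ≤ o) ■).
  family : Pred A.Carrier ℓ → (A.Carrier → C.Carrier) → Pred C.Carrier (suc ℓ)
  family D f x = Lift (suc ℓ) (∃ λ a → D a × (x C.≈ f a))

  ⋀-family-lower : ∀ {D f a} → D a → ⋀ (family D f) C.≤ f a
  ⋀-family-lower {a = a} Da = ⋀-lower _ _ (lift (a , Da , C.refl))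

  ⋁-family-upper : ∀ {D f a} → D a → f a C.≤ ⋁ (family D f)
  ⋁-family-upper {a = a} Da = ⋁-upper _ _ (lift (a , Da , C.refl))

  ⋀-img-antitone : ∀ {S S′ : Pred A.Carrier ℓ} → S ⊆ S′ → ⋀ (img S′) C.≤ ⋀ (img S)
  ⋀-img-antitone S⊆S′ =
    ⋀-greatest _ _ λ { x (lift (a , Sa , x≈ea)) → ⋀-lower _ _ (lift (a , S⊆S′ Sa , x≈ea)) }

  ⋁-img-monotone : ∀ {T T′ : Pred A.Carrier ℓ} → T ⊆ T′ → ⋁ (img T) C.≤ ⋁ (img T′)
  ⋁-img-monotone T⊆T′ =
    ⋁-least _ _ λ { x (lift (a , Ta , x≈ea)) → ⋁-upper _ _ (lift (a , T⊆T′ Ta , x≈ea)) }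

  e-monotone : ∀ {a b} → a A.≤ b → e a C.≤ e b
  e-monotone = Monotone.∧-preserving⇒monotone A C e e-cong e-∧

  x≤e⊤ : ∀ x → x C.≤ e A.⊤
  x≤e⊤ x = ≤-respʳ-≈ (C.sym e-⊤) (x≤⊤ x)

  ≤e-∧ : ∀ {x a b} → x C.≤ e a → x C.≤ e b → x C.≤ e (a A.∧ b)
  ≤e-∧ x≤a x≤b = ≤-respʳ-≈ (C.sym (e-∧ _ _)) (∧-greatest x≤a x≤b)

  e⊥≤x : ∀ x → e A.⊥ C.≤ x
  e⊥≤x x = ≤-respˡ-≈ (C.sym e-⊥) (⊥≤x x)

  e∨-least : ∀ {x a b} → e a C.≤ x → e b C.≤ x → e (a A.∨ b) C.≤ x
  e∨-least a≤x b≤x = ≤-respˡ-≈ (C.sym (e-∨ _ _)) (∨-least a≤x b≤x)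

  ⋀img≤e⋀fin : ∀ {S} {ss} → All S ss → ⋀ (img S) C.≤ e (A.⋀fin ss)
  ⋀img≤e⋀fin [] = x≤e⊤ _
  ⋀img≤e⋀fin (Ss ∷ Sss) = ≤e-∧ (⋀-family-lower Ss) (⋀img≤e⋀fin Sss)

  e⋁fin≤⋁img : ∀ {T} {ts} → All T ts → e (A.⋁fin ts) C.≤ ⋁ (img T)
  e⋁fin≤⋁img [] = e⊥≤x _
  e⋁fin≤⋁img (Tt ∷ Tts) = e∨-least (⋁-family-upper Tt) (e⋁fin≤⋁img Tts)

  interpolate : ∀ {k o} → Closed k → Open o → k C.≤ o → ∃ λ a → (k C.≤ e a) × (e a C.≤ o)
  interpolate {k} {o} (S , k≈) (T , o≈) k≤o
    with compact S T (≤-respˡ-≈ k≈ (≤-respʳ-≈ o≈ k≤o))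
  ... | ss , ts , Sss , Tts , ⋀ss≤⋁ts =
    A.⋀fin ss , ≤-respˡ-≈ (C.sym k≈) (⋀img≤e⋀fin Sss) ,
    ≤-trans (e-monotone ⋀ss≤⋁ts) (≤-respʳ-≈ (C.sym o≈) (e⋁fin≤⋁img Tts))

  module _ (D : Pred A.Carrier ℓ) (f : A.Carrier → C.Carrier) (f-closed : ∀ a → Closed (f a))
           (D-⊤ : D A.⊤) (D-∧ : ∀ {a b} → D a → D b → D (a A.∧ b))
           (f-monotone : ∀ {a b} → a A.≤ b → f a C.≤ f b) where

    closedGenerators : Pred A.Carrier ℓ
    closedGenerators c = ∃ λ a → D a × proj₁ (f-closed a) c

    ⋀closedGenerators≤⋀family : ⋀ (img closedGenerators) C.≤ ⋀ (family D f)
    ⋀closedGenerators≤⋀family = ⋀-greatest _ _ λ { x (lift (a , Da , x≈fa)) → begin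
      ⋀ (img closedGenerators)     ≤⟨ ⋀-img-antitone (λ Sc → a , Da , Sc) ⟩
      ⋀ (img (proj₁ (f-closed a))) ≈⟨ C.sym (proj₂ (f-closed a)) ⟩
      f a                          ≈⟨ C.sym x≈fa ⟩
      x                            ∎ }

    member-below-e⋀fin : ∀ {cs} → All closedGenerators cs → ∃ λ a → D a × (f a C.≤ e (A.⋀fin cs))
    member-below-e⋀fin [] = A.⊤ , D-⊤ , x≤e⊤ _
    member-below-e⋀fin {c ∷ _} ((a , Da , Sc) ∷ gcs) with member-below-e⋀fin gcs
    ... | a′ , Da′ , fa′≤ = a A.∧ a′ , D-∧ Da Da′ , ≤e-∧
      (begin
        f (a A.∧ a′)                 ≤⟨ f-monotone (AO.x∧y≤x a a′) ⟩
        f a                          ≈⟨ proj₂ (f-closed a) ⟩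
        ⋀ (img (proj₁ (f-closed a))) ≤⟨ ⋀-family-lower Sc ⟩
        e c                          ∎)
      (≤-trans (f-monotone (AO.x∧y≤y a a′)) fa′≤)

    filtered-⋀-compact : ∀ {o} → Open o → ⋀ (family D f) C.≤ o → ∃ λ a → D a × (f a C.≤ o)
    filtered-⋀-compact {o} (T , o≈) ⋀≤o
      with compact closedGenerators T
             (≤-respʳ-≈ o≈ (≤-trans ⋀closedGenerators≤⋀family ⋀≤o))
    ... | cs , ts , gcs , Tts , ⋀cs≤⋁ts with member-below-e⋀fin gcs
    ... | a , Da , fa≤ = a , Da , (begin
      f a              ≤⟨ fa≤ ⟩
      e (A.⋀fin cs)    ≤⟨ e-monotone ⋀cs≤⋁ts ⟩
      e (A.⋁fin ts)    ≤⟨ e⋁fin≤⋁img Tts ⟩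
      ⋁ (img T)        ≈⟨ C.sym o≈ ⟩
      o                ∎)

  module _ (D : Pred A.Carrier ℓ) (g : A.Carrier → C.Carrier) (g-open : ∀ b → Open (g b))
           (D-⊥ : D A.⊥) (D-∨ : ∀ {a b} → D a → D b → D (a A.∨ b))
           (g-monotone : ∀ {a b} → a A.≤ b → g a C.≤ g b) where

    openGenerators : Pred A.Carrier ℓ
    openGenerators c = ∃ λ b → D b × proj₁ (g-open b) c

    ⋁family≤⋁openGenerators : ⋁ (family D g) C.≤ ⋁ (img openGenerators)
    ⋁family≤⋁openGenerators = ⋁-least _ _ λ { x (lift (b , Db , x≈gb)) → begin
      x                          ≈⟨ x≈gb ⟩
      g b                        ≈⟨ proj₂ (g-open b) ⟩
      ⋁ (img (proj₁ (g-open b))) ≤⟨ ⋁-img-monotone (λ Tc → b , Db , Tc) ⟩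
      ⋁ (img openGenerators)     ∎ }

    member-above-e⋁fin : ∀ {cs} → All openGenerators cs → ∃ λ b → D b × (e (A.⋁fin cs) C.≤ g b)
    member-above-e⋁fin [] = A.⊥ , D-⊥ , e⊥≤x _
    member-above-e⋁fin {c ∷ _} ((b , Db , Tc) ∷ gcs) with member-above-e⋁fin gcs
    ... | b′ , Db′ , ≤gb′ = b A.∨ b′ , D-∨ Db Db′ , e∨-least
      (begin
        e c                        ≤⟨ ⋁-family-upper Tc ⟩
        ⋁ (img (proj₁ (g-open b))) ≈⟨ C.sym (proj₂ (g-open b)) ⟩
        g b                        ≤⟨ g-monotone (AO.x≤x∨y b b′) ⟩
        g (b A.∨ b′)               ∎)
      (≤-trans ≤gb′ (g-monotone (AO.y≤x∨y b b′)))

    ideal-⋁-compact : ∀ {k} → Closed k → k C.≤ ⋁ (family D g) → ∃ λ b → D b × (k C.≤ g b)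
    ideal-⋁-compact {k} (S , k≈) k≤⋁
      with compact S openGenerators
             (≤-respˡ-≈ k≈ (≤-trans k≤⋁ ⋁family≤⋁openGenerators))
    ... | ss , cs , Sss , gcs , ⋀ss≤⋁cs with member-above-e⋁fin gcs
    ... | b , Db , ≤gb = b , Db , (begin
      k                ≈⟨ k≈ ⟩
      ⋀ (img S)        ≤⟨ ⋀img≤e⋀fin Sss ⟩
      e (A.⋀fin ss)    ≤⟨ e-monotone ⋀ss≤⋁cs ⟩
      e (A.⋁fin cs)    ≤⟨ ≤gb ⟩
      g b              ∎)

  ≤-from-closed : ∀ {u v} → (∀ {k} → Closed k → k C.≤ u → k C.≤ v) → u C.≤ v
  ≤-from-closed {u} below =
    ≤-respˡ-≈ (C.sym (dense-closed u)) (⋁-least _ _ λ { k (closed , k≤u) → below closed k≤u })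

  ≤-from-open : ∀ {u v} → (∀ {o} → Open o → v C.≤ o → u C.≤ o) → u C.≤ v
  ≤-from-open {v = v} above =
    ≤-respʳ-≈ (C.sym (dense-open v)) (⋀-greatest _ _ λ { o (open′ , v≤o) → above open′ v≤o })

module TenseSlantedExtension {ℓ : Level} {A C : BooleanAlgebra ℓ ℓ} (ext : CanonicalExtension A C)
                             (◇ ■ : BA.Carrier A → BA.Carrier C)
                             (ts : IsTenseSlanted ext ◇ ■) where
  private
    module A = BA A
    module C = BA C
  open BooleanOrder C
  open CanonicalExtension ext
  open CanonicalExtensionProperties ext
  open IsTenseSlanted ts
  open Extensions ext ◇ ■
  open ≤-Reasoning poset

  ◇-monotone : ∀ {a b} → a A.≤ b → ◇ a C.≤ ◇ b
  ◇-monotone = Monotone.∨-preserving⇒monotone A C ◇ ◇-cong ◇-∨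

  ■-monotone : ∀ {a b} → a A.≤ b → ■ a C.≤ ■ b
  ■-monotone = Monotone.∧-preserving⇒monotone A C ■ ■-cong ■-∧

  ◇σK≤⇒≤■πO : ∀ {k o} → Closed k → Open o → ◇σK k C.≤ o → k C.≤ ■πO o
  ◇σK≤⇒≤■πO {k} {o} closed open′ ◇σKk≤o =
    case filtered-⋀-compact (λ a → k C.≤ e a) ◇ ◇-closed (x≤e⊤ k) ≤e-∧ ◇-monotone open′ ◇σKk≤o of λ
    { (a , k≤a , ◇a≤o) → case interpolate (◇-closed a) open′ ◇a≤o of λ
    { (b , ◇a≤b , b≤o) → begin
        k      ≤⟨ k≤a ⟩
        e a    ≤⟨ adj⇒ a b ◇a≤b ⟩
        ■ b    ≤⟨ ⋁-family-upper {D = λ b → e b C.≤ o} b≤o ⟩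
        ■πO o  ∎ } }

  ≤■πO⇒◇σK≤ : ∀ {k o} → Closed k → Open o → k C.≤ ■πO o → ◇σK k C.≤ o
  ≤■πO⇒◇σK≤ {k} {o} closed open′ k≤■πOo =
    case ideal-⋁-compact (λ b → e b C.≤ o) ■ ■-open (e⊥≤x o) e∨-least ■-monotone closed k≤■πOo of λ
    { (b , b≤o , k≤■b) → case interpolate closed (■-open b) k≤■b of λ
    { (a , k≤a , a≤■b) → begin
        ◇σK k  ≤⟨ ⋀-family-lower {D = λ a → k C.≤ e a} k≤a ⟩
        ◇ a    ≤⟨ adj⇐ a b a≤■b ⟩
        e b    ≤⟨ b≤o ⟩
        o      ∎ } }

  ◇σK≤◇σ : ∀ {k u} → Closed k → k C.≤ u → ◇σK k C.≤ ◇σ u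
  ◇σK≤◇σ closed k≤u = ⋁-upper _ _ (_ , closed , k≤u , C.refl)

  ■π≤■πO : ∀ {o u} → Open o → u C.≤ o → ■π u C.≤ ■πO o
  ■π≤■πO open′ u≤o = ⋀-lower _ _ (_ , open′ , u≤o , C.refl)

  ◇σ-least : ∀ {u v} → (∀ {k} → Closed k → k C.≤ u → ◇σK k C.≤ v) → ◇σ u C.≤ v
  ◇σ-least below = ⋁-least _ _ λ { x (k , closed , k≤u , x≈) → ≤-respˡ-≈ (C.sym x≈) (below closed k≤u) }

  ■π-greatest : ∀ {u v} → (∀ {o} → Open o → v C.≤ o → u C.≤ ■πO o) → u C.≤ ■π v
  ■π-greatest above = ⋀-greatest _ _ λ { x (o , open′ , v≤o , x≈) → ≤-respʳ-≈ (C.sym x≈) (above open′ v≤o) }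

  ◇σ≤⇒≤■π : ∀ u v → ◇σ u C.≤ v → u C.≤ ■π v
  ◇σ≤⇒≤■π u v ◇σu≤v = ■π-greatest λ open′ v≤o → ≤-from-closed λ closed k≤u →
    ◇σK≤⇒≤■πO closed open′ (≤-trans (◇σK≤◇σ closed k≤u) (≤-trans ◇σu≤v v≤o))

  ≤■π⇒◇σ≤ : ∀ u v → u C.≤ ■π v → ◇σ u C.≤ v
  ≤■π⇒◇σ≤ u v u≤■πv = ◇σ-least λ closed k≤u → ≤-from-open λ open′ v≤o →
    ≤■πO⇒◇σK≤ closed open′ (≤-trans k≤u (≤-trans u≤■πv (■π≤■πO open′ v≤o)))

lemma6p5 : {ℓ : Level} (A C : BooleanAlgebra ℓ ℓ) (ext : CanonicalExtension A C)
           (◇ ■ : BooleanAlgebra.Carrier A → BooleanAlgebra.Carrier C) →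
           IsTenseSlanted ext ◇ ■ →
           IsPerfectTenseBAE C (Extensions.◇σ ext ◇ ■) (Extensions.■π ext ◇ ■)
lemma6p5 A C ext ◇ ■ ts = record
  { completeAtomic = CanonicalExtension.completeAtomic ext
  ; adjunction⇒ = ◇σ≤⇒≤■π
  ; adjunction⇐ = ≤■π⇒◇σ≤
  }
  where open TenseSlantedExtension ext ◇ ■ ts
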